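{- For every $n\ge 3$ let $G_n$ be the graph $C_n\vee \overline{K_2}$, where $V(\overline{K_2})=\{x_n,y_n\}$. For $m,n\ge 3$, let $I_y(G_m,G_n)$ be the graph obtained from disjoint copies of $G_m$ and $G_n$ by identifying the vertices $y_m$ and $y_n$ into a single new vertex $y$. Then $$\chi_{\text{so}}(I_y(G_m,G_n))=\chi_{\text{so}}(W_m)+\chi_{\text{so}}(W_n)-1,$$ where $W_k=C_k\vee K_1$ denotes the wheel graph on $k+1$ vertices.
   Context: All graphs are finite and simple. A strong odd coloring of a graph $G$ is a proper vertex coloring of $G$ such that for every vertex $v$ and every color $c$, the number of neighbors of $v$ colored $c$ is either $0$ or odd. The strong odd chromatic number $\chi_{\text{so}}(G)$ is the minimum number of colors in a strong odd coloring of $G$. The join $G_1\vee G_2$ is obtained from disjoint copies of $G_1$ and $G_2$ by adding all edges between $V(G_1)$ and $V(G_2)$; $C_n$ is the cycle on $n$ vertices and $\overline{K_2}$ is the edgeless graph on two vertices. -}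

module Defs where

open import Data.Nat using (ℕ; zero; suc; _+_; _*_; _∸_; _≤_; _≡ᵇ_)
open import Data.Fin using (Fin; zero; suc; toℕ; splitAt; _≟_)
open import Data.Bool using (Bool; true; false; _∧_; _∨_)
open import Data.Sum using (_⊎_; inj₁; inj₂)
open import Data.Product using (Σ; _×_; ∃; _,_)
open import Relation.Nullary using (¬_)
open import Relation.Nullary.Decidable using (⌊_⌋)
open import Relation.Binary.PropositionalEquality using (_≡_; _≢_)

-- A (finite, simple) graph on the vertex set Fin N, given by a Boolean
-- adjacency function.  All graphs built below are symmetric and loopless.
Graph : ℕ → Set
Graph N = Fin N → Fin N → Bool

Empty : (N : ℕ) → Graph N
Empty N _ _ = false

cycSucc : (n : ℕ) → Fin n → Fin n → Bool
cycSucc n i j = (suc (toℕ i) ≡ᵇ toℕ j) ∨ ((suc (toℕ i) ≡ᵇ n) ∧ (toℕ j ≡ᵇ 0))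

C : (n : ℕ) → Graph n
C n i j = cycSucc n i j ∨ cycSucc n j i

join : ∀ {a b} → Graph a → Graph b → Graph (a + b)
join {a} {b} G H u v with splitAt a u | splitAt a v
... | inj₁ x | inj₁ y = G x y
... | inj₂ x | inj₂ y = H x y
... | inj₁ _ | inj₂ _ = true
... | inj₂ _ | inj₁ _ = true

-- Vertices: those of G, then those of H
-- other than zero (vertex suc j of H becomes vertex a + j).
identify : ∀ {a b} → Graph a → Fin a → Graph (suc b) → Graph (a + b)
identify {a} {b} G u H p q with splitAt a p | splitAt a q
... | inj₁ x | inj₁ y = G x y
... | inj₂ x | inj₂ y = H (suc x) (suc y)
... | inj₁ x | inj₂ y = ⌊ x ≟ u ⌋ ∧ H zero (suc y)
... | inj₂ x | inj₁ y = ⌊ y ≟ u ⌋ ∧ H (suc x) zero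

W : (k : ℕ) → Graph (k + 1)
W k = join (C k) (Empty 1)

-- G_n = C_n ∨ K̄₂, written as K̄₂ ∨ C_n with V(K̄₂) = {y_n, x_n} = {0, 1}.
Gn : (n : ℕ) → Graph (2 + n)
Gn n = join (Empty 2) (C n)

-- I_y(G_m, G_n): identify y_m (vertex 0 of G_m) with y_n (vertex 0 of G_n).
Iy : (m n : ℕ) → Graph ((2 + m) + (1 + n))
Iy m n = identify (Gn m) zero (Gn n)

countF : ∀ {N} → (Fin N → Bool) → ℕ
countF {zero} p = 0
countF {suc N} p = (if-true (p zero)) + countF (λ i → p (suc i))
  where
  if-true : Bool → ℕ
  if-true true = 1
  if-true false = 0

Odd : ℕ → Set
Odd n = ∃ λ k → n ≡ suc (2 * k)

nbrCount : ∀ {N k} → Graph N → (Fin N → Fin k) → Fin N → Fin k → ℕ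
nbrCount G col v c = countF (λ u → G v u ∧ ⌊ col u ≟ c ⌋)

IsStrongOdd : ∀ {N k} → Graph N → (Fin N → Fin k) → Set
IsStrongOdd G col =
  (∀ u v → G u v ≡ true → col u ≢ col v) ×
  (∀ v c → nbrCount G col v c ≡ 0 ⊎ Odd (nbrCount G col v c))

HasStrongOdd : ∀ {N} → Graph N → ℕ → Set
HasStrongOdd {N} G k = Σ (Fin N → Fin k) (IsStrongOdd G)

IsChiSO : ∀ {N} → Graph N → ℕ → Set
IsChiSO G k = HasStrongOdd G k × (∀ j → HasStrongOdd G j → k ≤ j)

{-# OPTIONS --safe #-}

-- In a strong odd colouring of I_y with k colours, colour the centre of W_s like y
-- and its rim like the cycle C_s.  This is a strong odd colouring of W_s: the centre sees what x_s
-- sees, and a rim vertex sees what it sees in I_y except x_s; as x_s is adjacent to all of C_s, its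
-- colour occurs at most once (at the centre) around a rim vertex.  A colour occurring on both
-- cycles occurs an odd number of times on each (count at x_m and at x_n), hence a positive even
-- number of times around y, which is impossible.  So the two wheel palettes share only the colour
-- of y, and χ_so(W_m) + χ_so(W_n) ≤ k + 1.
--
-- Recolour optimal colourings of W_m and W_n so that both centres get colour 0, merge
-- the two colours 0 into the colour of y and keep all other colours apart; x_s, which only sees C_s,
-- takes a rim colour of the other wheel.
module Submission where

open import Defs
open import Data.Bool using (Bool; true; false; _∧_; _∨_)
import Data.Bool as Bool
open import Data.Bool.Properties using (¬-not)
open import Data.Empty using (⊥-elim)
open import Data.Fin using (Fin; zero; suc; toℕ; fromℕ<; _↑ˡ_; _↑ʳ_; _≟_; splitAt)
import Data.Fin as Fin
open import Data.Fin.Permutation.Components using (transpose; transpose-inverse)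
open import Data.Fin.Properties
  using (suc-injective; any?; toℕ-fromℕ<; toℕ-injective; ↑ˡ-injective; ↑ʳ-injective;
         splitAt-↑ˡ; splitAt-↑ʳ; splitAt⁻¹-↑ˡ; splitAt⁻¹-↑ʳ; splitAt-join; join-splitAt)
open import Data.Nat using (ℕ; zero; suc; _+_; _∸_; _*_; _≤_; _<_; z≤n; s≤s)
open import Data.Nat.Properties
  using (+-assoc; +-comm; +-suc; +-identityʳ; +-cancelˡ-≡; +-mono-≤; +-monoʳ-≤; +-monoʳ-<; *-suc; *-distribˡ-+;
         ≤-refl; ≤-reflexive; ≤-trans; 1+n≢0; m+n≡0⇒m≡0; m+n≡0⇒n≡0; n≤0⇒n≡0; m≤n+m; even≢odd;
         ∸-monoˡ-≤; m+n∸n≡m; module ≤-Reasoning)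
open import Data.Product using (∃; _,_; _×_; proj₁; proj₂)
open import Data.Sum using (_⊎_; inj₁; inj₂; [_,_]′)
open import Function using (_∘_)
open import Relation.Binary.PropositionalEquality
open import Relation.Nullary using (yes; no; ¬_)
open import Relation.Nullary.Decidable using (⌊_⌋; dec-true)

ind : Bool → ℕ
ind true = 1
ind false = 0

ind≤1 : ∀ b → ind b ≤ 1
ind≤1 true = s≤s z≤n
ind≤1 false = z≤n

countF-suc : ∀ {N} (p : Fin (suc N) → Bool) → countF p ≡ ind (p zero) + countF (p ∘ suc)
countF-suc p with p zero
... | true = refl
... | false = refl

countF-cong : ∀ {N} {p q : Fin N → Bool} → (∀ i → p i ≡ q i) → countF p ≡ countF q
countF-cong {zero} eq = refl
countF-cong {suc N} {p} {q} eq = begin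
  countF p                       ≡⟨ countF-suc p ⟩
  ind (p zero) + countF (p ∘ suc) ≡⟨ cong₂ _+_ (cong ind (eq zero)) (countF-cong (eq ∘ suc)) ⟩
  ind (q zero) + countF (q ∘ suc) ≡⟨ countF-suc q ⟨
  countF q                       ∎
  where open ≡-Reasoning

countF-none : ∀ {N} {p : Fin N → Bool} → (∀ i → p i ≡ false) → countF p ≡ 0
countF-none {zero} none = refl
countF-none {suc N} {p} none =
  trans (countF-suc p) (cong₂ _+_ (cong ind (none zero)) (countF-none (none ∘ suc)))

countF-≢0 : ∀ {N} (p : Fin N → Bool) {i} → p i ≡ true → countF p ≢ 0
countF-≢0 p {zero} pi≡true eq rewrite countF-suc p | pi≡true = 1+n≢0 eq
countF-≢0 p {suc i} pi≡true eq rewrite countF-suc p =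
  countF-≢0 (p ∘ suc) pi≡true (m+n≡0⇒n≡0 (ind (p zero)) eq)

countF-↑ : ∀ a {b} (p : Fin (a + b) → Bool) →
  countF p ≡ countF (λ i → p (i ↑ˡ b)) + countF (λ j → p (a ↑ʳ j))
countF-↑ zero p = refl
countF-↑ (suc a) {b} p = begin
  countF p                                ≡⟨ countF-suc p ⟩
  ind (p zero) + countF (p ∘ suc)         ≡⟨ cong (ind (p zero) +_) (countF-↑ a (p ∘ suc)) ⟩
  ind (p zero) + (countF (pˡ ∘ suc) + R)  ≡⟨ +-assoc (ind (p zero)) _ _ ⟨
  ind (p zero) + countF (pˡ ∘ suc) + R    ≡⟨ cong (_+ R) (countF-suc pˡ) ⟨
  countF pˡ + R                           ∎
  where
  open ≡-Reasoning
  pˡ : Fin (suc a) → Bool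
  pˡ i = p (i ↑ˡ b)
  R : ℕ
  R = countF (λ j → p (suc a ↑ʳ j))

countF≤ : ∀ {N} (p : Fin N → Bool) → countF p ≤ N
countF≤ {zero} p = z≤n
countF≤ {suc N} p rewrite countF-suc p = +-mono-≤ (ind≤1 (p zero)) (countF≤ (p ∘ suc))

countF-mono : ∀ {N} {p q : Fin N → Bool} →
  (∀ i → p i ≡ true → q i ≡ true) → countF p ≤ countF q
countF-mono {zero} p⊆q = z≤n
countF-mono {suc N} {p} {q} p⊆q rewrite countF-suc p | countF-suc q =
  +-mono-≤ (ind-mono (p zero) (q zero) (p⊆q zero)) (countF-mono (p⊆q ∘ suc))
  where
  ind-mono : ∀ x y → (x ≡ true → y ≡ true) → ind x ≤ ind y
  ind-mono false y _ = z≤n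
  ind-mono true y x⇒y rewrite x⇒y refl = ≤-refl

countF-∨-∧ : ∀ {N} (p q : Fin N → Bool) →
  countF p + countF q ≡ countF (λ i → p i ∨ q i) + countF (λ i → p i ∧ q i)
countF-∨-∧ {zero} p q = refl
countF-∨-∧ {suc N} p q
  rewrite countF-suc p | countF-suc q | countF-suc (λ i → p i ∨ q i) | countF-suc (λ i → p i ∧ q i) =
  shuffle (p zero) (q zero) (countF-∨-∧ (p ∘ suc) (q ∘ suc))
  where
  shuffle : ∀ x y {A B C D} → A + B ≡ C + D →
    ind x + A + (ind y + B) ≡ ind (x ∨ y) + C + (ind (x ∧ y) + D)
  shuffle false false eq = eq
  shuffle false true {A} {B} eq = trans (+-suc A B) (cong suc eq)
  shuffle true false eq = cong suc eq
  shuffle true true {A} {B} {C} {D} eq = cong suc (trans (+-suc A B) (trans (cong suc eq) (sym (+-suc C D))))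

∧≡true : ∀ x {y} → x ∧ y ≡ true → x ≡ true × y ≡ true
∧≡true true eq = refl , eq

_==_ : ∀ {k} → Fin k → Fin k → Bool
x == y = ⌊ x ≟ y ⌋

==⇒≡ : ∀ {k} {x y : Fin k} → x == y ≡ true → x ≡ y
==⇒≡ {x = x} {y} eq with x ≟ y
... | yes x≡y = x≡y

≡⇒== : ∀ {k} {x y : Fin k} → x ≡ y → x == y ≡ true
≡⇒== {x = x} {y} x≡y with x ≟ y
... | yes _ = refl
... | no x≢y = ⊥-elim (x≢y x≡y)

≢⇒== : ∀ {k} {x y : Fin k} → x ≢ y → x == y ≡ false
≢⇒== {x = x} {y} x≢y with x ≟ y
... | yes x≡y = ⊥-elim (x≢y x≡y)
... | no _ = refl

==-cong-⇔ : ∀ {k l} {x y : Fin k} {x′ y′ : Fin l} →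
  (x ≡ y → x′ ≡ y′) → (x′ ≡ y′ → x ≡ y) → (x == y) ≡ (x′ == y′)
==-cong-⇔ {x = x} {y} to from with x ≟ y
... | yes x≡y = sym (≡⇒== (to x≡y))
... | no x≢y = sym (≢⇒== (x≢y ∘ from))

countF-== : ∀ {N} (d : Fin N) → countF (_== d) ≡ 1
countF-== {suc N} zero rewrite countF-suc (_== zero {N}) =
  cong suc (countF-none {N} {λ i → suc i == zero} λ _ → refl)
countF-== {suc N} (suc d) rewrite countF-suc (_== suc d) =
  trans (countF-cong {p = λ i → suc i == suc d} (λ i → ==-cong-⇔ suc-injective (cong suc))) (countF-== d)

countF+countF≤ : ∀ {N} (p q : Fin N → Bool) (i₀ : Fin N) →
  (∀ i → p i ∧ q i ≡ true → i ≡ i₀) → countF p + countF q ≤ N + 1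
countF+countF≤ {N} p q i₀ meet rewrite countF-∨-∧ p q =
  +-mono-≤ (countF≤ (λ i → p i ∨ q i))
           (≤-trans (countF-mono (λ i pq → ≡⇒== (meet i pq))) (≤-reflexive (countF-== i₀)))

ZeroOrOdd : ℕ → Set
ZeroOrOdd n = n ≡ 0 ⊎ Odd n

ind-ZeroOrOdd : ∀ b → ZeroOrOdd (ind b)
ind-ZeroOrOdd true = inj₂ (0 , refl)
ind-ZeroOrOdd false = inj₁ refl

odd+odd-¬ZeroOrOdd : ∀ {A B} → Odd A → Odd B → ¬ ZeroOrOdd (A + B)
odd+odd-¬ZeroOrOdd (a , refl) (b , refl) (inj₁ ())
odd+odd-¬ZeroOrOdd (a , refl) (b , refl) (inj₂ (k , eq)) = even≢odd (suc (a + b)) k (begin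
  2 * suc (a + b)             ≡⟨ *-suc 2 (a + b) ⟩
  suc (suc (2 * (a + b)))     ≡⟨ cong (2 +_) (*-distribˡ-+ 2 a b) ⟩
  suc (suc (2 * a + 2 * b))   ≡⟨ cong suc (+-suc (2 * a) (2 * b)) ⟨
  suc (2 * a) + suc (2 * b)   ≡⟨ eq ⟩
  suc (2 * k)                 ∎)
  where open ≡-Reasoning

module _ {N k} (G : Graph N) (col : Fin N → Fin k) where

  Proper : Set
  Proper = ∀ u v → G u v ≡ true → col u ≢ col v

  OddNeighbourhoods : Set
  OddNeighbourhoods = ∀ v c → ZeroOrOdd (nbrCount G col v c)

  Proper⇒nbrCount-own≡0 : Proper → ∀ v → nbrCount G col v (col v) ≡ 0
  Proper⇒nbrCount-own≡0 proper v = countF-none absent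
    where
    absent : ∀ u → (G v u ∧ col u == col v) ≡ false
    absent u with G v u in vu
    ... | true = ≢⇒== (λ eq → proper v u vu (sym eq))
    ... | false = refl

  nbrCount-own≡0⇒Proper : (∀ v → nbrCount G col v (col v) ≡ 0) → Proper
  nbrCount-own≡0⇒Proper none u v uv eq = countF-≢0 (λ w → G u w ∧ col w == col u) {v} present (none u)
    where
    present : (G u v ∧ col v == col u) ≡ true
    present rewrite uv = ≡⇒== (sym eq)

recolour : ∀ {N k l} {G : Graph N} {col : Fin N → Fin k} {col′ : Fin N → Fin l} →
  (∀ u v → col′ u ≡ col′ v → col u ≡ col v) →
  (∀ u v → col u ≡ col v → col′ u ≡ col′ v) →
  IsStrongOdd G col → IsStrongOdd G col′
recolour {G = G} {col} {col′} reflect preserve (proper , odd) =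
  (λ u v uv → proper u v uv ∘ reflect u v) , odd′
  where
  odd′ : OddNeighbourhoods G col′
  odd′ v c with any? (λ u → (G v u ∧ col′ u == c) Bool.≟ true)
  ... | no none = inj₁ (countF-none (λ u → ¬-not (λ present → none (u , present))))
  ... | yes (u₀ , present) with refl ← ==⇒≡ {x = col′ u₀} (proj₂ (∧≡true (G v u₀) present)) =
    subst ZeroOrOdd (countF-cong (λ u → cong (G v u ∧_) (==-cong-⇔ (preserve u u₀) (reflect u u₀))))
      (odd v (col u₀))

IsStrongOdd-≗ : ∀ {N k} {G : Graph N} {col col′ : Fin N → Fin k} →
  (∀ u → col u ≡ col′ u) → IsStrongOdd G col → IsStrongOdd G col′
IsStrongOdd-≗ col≗col′ = recolour (λ u v eq → trans (col≗col′ u) (trans eq (sym (col≗col′ v))))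
                                  (λ u v eq → trans (sym (col≗col′ u)) (trans eq (col≗col′ v)))

IsStrongOdd-∘ : ∀ {N k l} {G : Graph N} {col : Fin N → Fin k} {f : Fin k → Fin l} →
  (∀ {x y} → f x ≡ f y → x ≡ y) → IsStrongOdd G col → IsStrongOdd G (f ∘ col)
IsStrongOdd-∘ {f = f} f-inj = recolour (λ _ _ → f-inj) (λ _ _ → cong f)

transpose-injective : ∀ {n} (i j : Fin n) {x y} → transpose i j x ≡ transpose i j y → x ≡ y
transpose-injective i j {x} {y} eq = begin
  x                                ≡⟨ transpose-inverse j i ⟨
  transpose j i (transpose i j x)  ≡⟨ cong (transpose j i) eq ⟩
  transpose j i (transpose i j y)  ≡⟨ transpose-inverse j i ⟩
  y                                ∎
  where open ≡-Reasoning

transpose-source : ∀ {n} (i j : Fin n) → transpose i j i ≡ j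
transpose-source i j rewrite dec-true (i ≟ i) refl = refl

IsStrongOdd-zero-at : ∀ {N k} {G : Graph N} {col : Fin N → Fin (suc k)} → IsStrongOdd G col →
  ∀ v → ∃ λ col′ → IsStrongOdd G col′ × col′ v ≡ zero
IsStrongOdd-zero-at {col = col} so v =
  transpose (col v) zero ∘ col ,
  IsStrongOdd-∘ (transpose-injective (col v) zero) so ,
  transpose-source (col v) zero

image : ∀ {N k} → (Fin N → Fin k) → Fin k → Bool
image col c = ⌊ any? (λ u → col u ≟ c) ⌋

image-col : ∀ {N k} (col : Fin N → Fin k) u → image col (col u) ≡ true
image-col col u with any? (λ w → col w ≟ col u)
... | yes _ = refl
... | no none = ⊥-elim (none (u , refl))

image⇒∃ : ∀ {N k} (col : Fin N → Fin k) {c} → image col c ≡ true → ∃ λ u → col u ≡ c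
image⇒∃ col {c} eq with any? (λ u → col u ≟ c)
... | yes found = found

rank : ∀ {k} → (Fin k → Bool) → Fin k → ℕ
rank P zero = 0
rank P (suc c) = ind (P zero) + rank (P ∘ suc) c

rank< : ∀ {k} (P : Fin k → Bool) {c} → P c ≡ true → rank P c < countF P
rank< P {zero} Pc rewrite countF-suc P | Pc = s≤s z≤n
rank< P {suc c} Pc rewrite countF-suc P = +-monoʳ-< (ind (P zero)) (rank< (P ∘ suc) Pc)

rank-injective : ∀ {k} (P : Fin k → Bool) {c d} →
  P c ≡ true → P d ≡ true → rank P c ≡ rank P d → c ≡ d
rank-injective P {zero} {zero} _ _ _ = refl
rank-injective P {zero} {suc d} Pc _ eq rewrite Pc with () ← eq
rank-injective P {suc c} {zero} _ Pd eq rewrite Pd with () ← eq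
rank-injective P {suc c} {suc d} Pc Pd eq =
  cong suc (rank-injective (P ∘ suc) Pc Pd (+-cancelˡ-≡ (ind (P zero)) _ _ eq))

compress : ∀ {N k} {G : Graph N} {col : Fin N → Fin k} →
  IsStrongOdd G col → HasStrongOdd G (countF (image col))
compress {N} {col = col} so = col′ , recolour reflect preserve so
  where
  col′ : Fin N → Fin (countF (image col))
  col′ u = fromℕ< (rank< (image col) (image-col col u))
  toℕ-col′ : ∀ u → toℕ (col′ u) ≡ rank (image col) (col u)
  toℕ-col′ u = toℕ-fromℕ< (rank< (image col) (image-col col u))
  reflect : ∀ u v → col′ u ≡ col′ v → col u ≡ col v
  reflect u v eq = rank-injective (image col) (image-col col u) (image-col col v)
    (trans (sym (toℕ-col′ u)) (trans (cong toℕ eq) (toℕ-col′ v)))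
  preserve : ∀ u v → col u ≡ col v → col′ u ≡ col′ v
  preserve u v eq =
    toℕ-injective (trans (toℕ-col′ u) (trans (cong (rank (image col)) eq) (sym (toℕ-col′ v))))

cyc : ∀ {m} → Fin m → Fin (m + 1)
cyc i = i ↑ˡ 1

ctr : ∀ {m} → Fin (m + 1)
ctr {m} = m ↑ʳ zero

wheel-view : ∀ {m} (v : Fin (m + 1)) → (∃ λ i → v ≡ cyc i) ⊎ v ≡ ctr
wheel-view {m} v with splitAt m v in eq
... | inj₁ i = inj₁ (i , sym (splitAt⁻¹-↑ˡ eq))
... | inj₂ zero = inj₂ (sym (splitAt⁻¹-↑ʳ eq))

CentredStrongOdd : ℕ → ℕ → Set
CentredStrongOdd m k = ∃ λ (κ : Fin (m + 1) → Fin (suc k)) → IsStrongOdd (W m) κ × κ ctr ≡ zero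

wheelColouring : ∀ {m} {A : Set} → (Fin m → A) → A → Fin (m + 1) → A
wheelColouring {m} f h v = [ f , (λ _ → h) ]′ (splitAt m v)

module _ {m} {A : Set} (f : Fin m → A) (h : A) where

  wheelColouring-cyc : ∀ i → wheelColouring f h (cyc i) ≡ f i
  wheelColouring-cyc i rewrite splitAt-↑ˡ m i 1 = refl

  wheelColouring-ctr : wheelColouring f h ctr ≡ h
  wheelColouring-ctr rewrite splitAt-↑ʳ m 1 zero = refl

module _ {m : ℕ} where

  W-cyc-cyc : ∀ i j → W m (cyc i) (cyc j) ≡ C m i j
  W-cyc-cyc i j rewrite splitAt-↑ˡ m i 1 | splitAt-↑ˡ m j 1 = refl

  W-ctr-cyc : ∀ i → W m ctr (cyc i) ≡ true
  W-ctr-cyc i rewrite splitAt-↑ˡ m i 1 | splitAt-↑ʳ m 1 zero = refl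

  W-cyc-ctr : ∀ i → W m (cyc i) ctr ≡ true
  W-cyc-ctr i rewrite splitAt-↑ˡ m i 1 | splitAt-↑ʳ m 1 zero = refl

  W-ctr-ctr : W m ctr ctr ≡ false
  W-ctr-ctr rewrite splitAt-↑ʳ m 1 zero = refl

  countF-wheel : (p : Fin (m + 1) → Bool) → countF p ≡ ind (p ctr) + countF (p ∘ cyc)
  countF-wheel p = begin
    countF p                                        ≡⟨ countF-↑ m p ⟩
    countF (p ∘ cyc) + countF (λ j → p (m ↑ʳ j))
      ≡⟨ cong (countF (p ∘ cyc) +_) (countF-suc (λ j → p (m ↑ʳ j))) ⟩
    countF (p ∘ cyc) + (ind (p ctr) + 0)           ≡⟨ cong (countF (p ∘ cyc) +_) (+-identityʳ _) ⟩
    countF (p ∘ cyc) + ind (p ctr)                 ≡⟨ +-comm (countF (p ∘ cyc)) (ind (p ctr)) ⟩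
    ind (p ctr) + countF (p ∘ cyc)                 ∎
    where open ≡-Reasoning

  module _ {k} (κ : Fin (m + 1) → Fin k) (t : Fin k) where

    nbrCount-ctr : nbrCount (W m) κ ctr t ≡ countF (λ i → κ (cyc i) == t)
    nbrCount-ctr = begin
      nbrCount (W m) κ ctr t                                        ≡⟨ countF-wheel _ ⟩
      ind (W m ctr ctr ∧ κ ctr == t) + countF (λ i → W m ctr (cyc i) ∧ κ (cyc i) == t)
        ≡⟨ cong₂ (λ b q → ind (b ∧ κ ctr == t) + q) W-ctr-ctr
                 (countF-cong (λ i → cong (_∧ κ (cyc i) == t) (W-ctr-cyc i))) ⟩
      countF (λ i → κ (cyc i) == t)                                 ∎
      where open ≡-Reasoning

    nbrCount-cyc : ∀ i →
      nbrCount (W m) κ (cyc i) t ≡ ind (κ ctr == t) + countF (λ j → C m i j ∧ κ (cyc j) == t)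
    nbrCount-cyc i = trans (countF-wheel _)
      (cong₂ (λ b q → ind (b ∧ κ ctr == t) + q) (W-cyc-ctr i)
             (countF-cong (λ j → cong (_∧ κ (cyc j) == t) (W-cyc-cyc i j))))

identifyₛ : ∀ {a b} → Graph a → Fin a → Graph (suc b) → Fin a ⊎ Fin b → Fin a ⊎ Fin b → Bool
identifyₛ G u H (inj₁ p) (inj₁ q) = G p q
identifyₛ G u H (inj₂ p) (inj₂ q) = H (suc p) (suc q)
identifyₛ G u H (inj₁ p) (inj₂ q) = p == u ∧ H zero (suc q)
identifyₛ G u H (inj₂ p) (inj₁ q) = q == u ∧ H (suc p) zero

identify-splitAt : ∀ {a b} (G : Graph a) u (H : Graph (suc b)) p q →
  identify G u H p q ≡ identifyₛ G u H (splitAt a p) (splitAt a q)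
identify-splitAt {a} G u H p q with splitAt a p | splitAt a q
... | inj₁ _ | inj₁ _ = refl
... | inj₁ _ | inj₂ _ = refl
... | inj₂ _ | inj₁ _ = refl
... | inj₂ _ | inj₂ _ = refl

data Side : Set where
  left right : Side

opposite : Side → Side
opposite left = right
opposite right = left

opposite≢ : ∀ s → opposite s ≢ s
opposite≢ left ()
opposite≢ right ()

sided : {A : Set} → A → A → Side → A
sided a b left = a
sided a b right = b

module IyStructure (m n : ℕ) where

  len : Side → ℕ
  len = sided m n

  -- Side left is the G_m copy: x left = x_m and c left i is the i-th vertex of C_m.
  data Vertex : Set where
    y : Vertex
    x : Side → Vertex
    c : (s : Side) → Fin (len s) → Vertex

  Region : Set
  Region = Fin (2 + m) ⊎ Fin (1 + n)

  region : Vertex → Region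
  region y = inj₁ zero
  region (x left) = inj₁ (suc zero)
  region (c left i) = inj₁ (suc (suc i))
  region (x right) = inj₂ zero
  region (c right i) = inj₂ (suc i)

  unregion : Region → Vertex
  unregion (inj₁ zero) = y
  unregion (inj₁ (suc zero)) = x left
  unregion (inj₁ (suc (suc i))) = c left i
  unregion (inj₂ zero) = x right
  unregion (inj₂ (suc i)) = c right i

  unregion-region : ∀ v → unregion (region v) ≡ v
  unregion-region y = refl
  unregion-region (x left) = refl
  unregion-region (x right) = refl
  unregion-region (c left i) = refl
  unregion-region (c right i) = refl

  region-unregion : ∀ r → region (unregion r) ≡ r
  region-unregion (inj₁ zero) = refl
  region-unregion (inj₁ (suc zero)) = refl
  region-unregion (inj₁ (suc (suc i))) = refl
  region-unregion (inj₂ zero) = refl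
  region-unregion (inj₂ (suc i)) = refl

  N : ℕ
  N = (2 + m) + (1 + n)

  toFin : Vertex → Fin N
  toFin = Fin.join (2 + m) (1 + n) ∘ region

  fromFin : Fin N → Vertex
  fromFin = unregion ∘ splitAt (2 + m)

  fromFin-toFin : ∀ v → fromFin (toFin v) ≡ v
  fromFin-toFin v = trans (cong unregion (splitAt-join (2 + m) (1 + n) (region v))) (unregion-region v)

  toFin-fromFin : ∀ p → toFin (fromFin p) ≡ p
  toFin-fromFin p =
    trans (cong (Fin.join (2 + m) (1 + n)) (region-unregion (splitAt (2 + m) p))) (join-splitAt (2 + m) (1 + n) p)

  -- On vertices given by constructors, adj reduces by computation to the adjacency of I_y.
  adj : Vertex → Vertex → Bool
  adj v w = identifyₛ (Gn m) zero (Gn n) (region v) (region w)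

  Iy-adj : ∀ v w → Iy m n (toFin v) (toFin w) ≡ adj v w
  Iy-adj v w = trans (identify-splitAt (Gn m) zero (Gn n) (toFin v) (toFin w))
    (cong₂ (identifyₛ (Gn m) zero (Gn n)) (splitAt-join (2 + m) (1 + n) (region v))
                                          (splitAt-join (2 + m) (1 + n) (region w)))

  sideSum : (Vertex → Bool) → Side → ℕ
  sideSum f s = ind (f (x s)) + countF (f ∘ c s)

  Σᵥ : (Vertex → Bool) → ℕ
  Σᵥ f = ind (f y) + (sideSum f left + sideSum f right)

  countF-toFin : (p : Fin N → Bool) → countF p ≡ Σᵥ (p ∘ toFin)
  countF-toFin p = begin
    countF p               ≡⟨ countF-↑ (2 + m) p ⟩
    countF pˡ + countF pʳ  ≡⟨ cong₂ _+_ (countF-suc pˡ) (countF-suc pʳ) ⟩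
    ind (p (toFin y)) + countF (pˡ ∘ suc) + sideSum (p ∘ toFin) right
      ≡⟨ cong (λ q → ind (p (toFin y)) + q + sideSum (p ∘ toFin) right) (countF-suc (pˡ ∘ suc)) ⟩
    ind (p (toFin y)) + sideSum (p ∘ toFin) left + sideSum (p ∘ toFin) right
      ≡⟨ +-assoc (ind (p (toFin y))) _ _ ⟩
    Σᵥ (p ∘ toFin)
      ∎
    where
    open ≡-Reasoning
    pˡ : Fin (2 + m) → Bool
    pˡ i = p (i ↑ˡ (1 + n))
    pʳ : Fin (1 + n) → Bool
    pʳ j = p ((2 + m) ↑ʳ j)

  Σᵥ-cong : ∀ {f g : Vertex → Bool} → (∀ v → f v ≡ g v) → Σᵥ f ≡ Σᵥ g
  Σᵥ-cong {f} {g} f≗g =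
    cong₂ _+_ (cong ind (f≗g y)) (cong₂ _+_ (sideSum-cong left) (sideSum-cong right))
    where
    sideSum-cong : ∀ s → sideSum f s ≡ sideSum g s
    sideSum-cong s = cong₂ _+_ (cong ind (f≗g (x s))) (countF-cong (f≗g ∘ c s))

  toFin-elim : ∀ {P : Fin N → Set} → (∀ v → P (toFin v)) → ∀ p → P p
  toFin-elim {P} h p = subst P (toFin-fromFin p) (h (fromFin p))

  colouring : ∀ {k} → (Vertex → Fin k) → Fin N → Fin k
  colouring f = f ∘ fromFin

  module _ {k} (f : Vertex → Fin k) where

    cycleCount : Side → Fin k → ℕ
    cycleCount s t = countF (λ i → f (c s i) == t)

    nbrCount-Σᵥ : ∀ v t →
      nbrCount (Iy m n) (colouring f) (toFin v) t ≡ Σᵥ (λ w → adj v w ∧ f w == t)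
    nbrCount-Σᵥ v t = trans (countF-toFin (λ p → Iy m n (toFin v) p ∧ colouring f p == t))
      (Σᵥ-cong λ w → cong₂ (λ b u → b ∧ f u == t) (Iy-adj v w) (fromFin-toFin w))

    nbrCount-y : ∀ t → nbrCount (Iy m n) (colouring f) (toFin y) t ≡ cycleCount left t + cycleCount right t
    nbrCount-y = nbrCount-Σᵥ y

    nbrCount-x : ∀ s t → nbrCount (Iy m n) (colouring f) (toFin (x s)) t ≡ cycleCount s t
    nbrCount-x left t = trans (nbrCount-Σᵥ (x left) t)
      (trans (cong (cycleCount left t +_) (countF-none {n} λ _ → refl)) (+-identityʳ _))
    nbrCount-x right t = trans (nbrCount-Σᵥ (x right) t)
      (cong (_+ cycleCount right t) (countF-none {m} λ _ → refl))

    nbrCount-c : ∀ s i t → nbrCount (Iy m n) (colouring f) (toFin (c s i)) t ≡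
      ind (f y == t) + (ind (f (x s) == t) + countF (λ j → C (len s) i j ∧ f (c s j) == t))
    nbrCount-c left i t = trans (nbrCount-Σᵥ (c left i) t)
      (cong (ind (f y == t) +_) (trans (cong (sideSum (λ w → adj (c left i) w ∧ f w == t) left +_)
        (countF-none {n} λ _ → refl)) (+-identityʳ _)))
    nbrCount-c right i t = trans (nbrCount-Σᵥ (c right i) t)
      (cong (λ q → ind (f y == t) + (q + sideSum (λ w → adj (c right i) w ∧ f w == t) right))
        (countF-none {m} λ _ → refl))

    Proper⇒nbrCount-own≡0ᵥ : Proper (Iy m n) (colouring f) →
      ∀ v → nbrCount (Iy m n) (colouring f) (toFin v) (f v) ≡ 0
    Proper⇒nbrCount-own≡0ᵥ proper v =
      subst (λ t → nbrCount (Iy m n) (colouring f) (toFin v) t ≡ 0) (cong f (fromFin-toFin v))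
        (Proper⇒nbrCount-own≡0 (Iy m n) (colouring f) proper (toFin v))

    nbrCount-own≡0⇒Properᵥ : (∀ v → nbrCount (Iy m n) (colouring f) (toFin v) (f v) ≡ 0) →
      Proper (Iy m n) (colouring f)
    nbrCount-own≡0⇒Properᵥ own≡0 = nbrCount-own≡0⇒Proper (Iy m n) (colouring f) (toFin-elim λ v →
      subst (λ t → nbrCount (Iy m n) (colouring f) (toFin v) t ≡ 0) (cong f (sym (fromFin-toFin v)))
        (own≡0 v))

module Restriction {m n k : ℕ} (f : IyStructure.Vertex m n → Fin k)
                   (so : IsStrongOdd (Iy m n) (IyStructure.colouring m n f)) where

  open IyStructure m n

  nbrᴵ : Vertex → Fin k → ℕ
  nbrᴵ v = nbrCount (Iy m n) (colouring f) (toFin v)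

  odd-at : ∀ v t → ZeroOrOdd (nbrᴵ v t)
  odd-at v = proj₂ so (toFin v)

  own≡0 : ∀ v → nbrᴵ v (f v) ≡ 0
  own≡0 = Proper⇒nbrCount-own≡0ᵥ f (proj₁ so)

  restrict : (s : Side) → Fin (len s + 1) → Fin k
  restrict s = wheelColouring (f ∘ c s) (f y)

  restrict-ctr : ∀ s → restrict s ctr ≡ f y
  restrict-ctr s = wheelColouring-ctr (f ∘ c s) (f y)

  restrict-cyc : ∀ s i → restrict s (cyc i) ≡ f (c s i)
  restrict-cyc s = wheelColouring-cyc (f ∘ c s) (f y)

  nbrᵂ : (s : Side) → Fin (len s + 1) → Fin k → ℕ
  nbrᵂ s = nbrCount (W (len s)) (restrict s)

  nbrCount-restrict-ctr : ∀ s t → nbrᵂ s ctr t ≡ cycleCount f s t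
  nbrCount-restrict-ctr s t =
    trans (nbrCount-ctr (restrict s) t) (countF-cong (λ i → cong (_== t) (restrict-cyc s i)))

  nbrCount-restrict-cyc : ∀ s i t → nbrᵂ s (cyc i) t ≡
    ind (f y == t) + countF (λ j → C (len s) i j ∧ f (c s j) == t)
  nbrCount-restrict-cyc s i t = trans (nbrCount-cyc (restrict s) t i)
    (cong₂ (λ h q → ind (h == t) + q) (restrict-ctr s)
      (countF-cong (λ j → cong (λ u → C (len s) i j ∧ u == t) (restrict-cyc s j))))

  cycleCount-x≡0 : ∀ s → cycleCount f s (f (x s)) ≡ 0
  cycleCount-x≡0 s = trans (sym (nbrCount-x f s (f (x s)))) (own≡0 (x s))

  cycleCount-y≡0 : ∀ s → cycleCount f s (f y) ≡ 0
  cycleCount-y≡0 left = m+n≡0⇒m≡0 _ (trans (sym (nbrCount-y f (f y))) (own≡0 y))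
  cycleCount-y≡0 right = m+n≡0⇒n≡0 (cycleCount f left (f y)) (trans (sym (nbrCount-y f (f y))) (own≡0 y))

  cycleCount-odd : ∀ s i → Odd (cycleCount f s (f (c s i)))
  cycleCount-odd s i with subst ZeroOrOdd (nbrCount-x f s (f (c s i))) (odd-at (x s) (f (c s i)))
  ... | inj₁ none = ⊥-elim (countF-≢0 (λ j → f (c s j) == f (c s i)) {i} (≡⇒== refl) none)
  ... | inj₂ odd = odd

  restrict-IsStrongOdd : ∀ s → IsStrongOdd (W (len s)) (restrict s)
  restrict-IsStrongOdd s = nbrCount-own≡0⇒Proper (W (len s)) (restrict s) restrict-own≡0 , restrict-odd
    where
    nbrCount-restrict-cyc≤ : ∀ i t →
      nbrᵂ s (cyc i) t ≤ nbrᴵ (c s i) t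
    nbrCount-restrict-cyc≤ i t rewrite nbrCount-restrict-cyc s i t | nbrCount-c f s i t =
      +-monoʳ-≤ (ind (f y == t)) (m≤n+m _ _)

    restrict-own≡0 : ∀ v → nbrᵂ s v (restrict s v) ≡ 0
    restrict-own≡0 v with wheel-view v
    ... | inj₂ refl rewrite restrict-ctr s = trans (nbrCount-restrict-ctr s (f y)) (cycleCount-y≡0 s)
    ... | inj₁ (i , refl) rewrite restrict-cyc s i =
      n≤0⇒n≡0 (≤-trans (nbrCount-restrict-cyc≤ i (f (c s i))) (≤-reflexive (own≡0 (c s i))))

    restrict-odd : OddNeighbourhoods (W (len s)) (restrict s)
    restrict-odd v t with wheel-view v
    ... | inj₂ refl =
      subst ZeroOrOdd (trans (nbrCount-x f s t) (sym (nbrCount-restrict-ctr s t))) (odd-at (x s) t)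
    ... | inj₁ (i , refl) rewrite nbrCount-restrict-cyc s i t with f (x s) ≟ t
    ...   | no x≢t =
      subst ZeroOrOdd (trans (nbrCount-c f s i t) (cong (λ b → ind (f y == t) + (ind b + D)) (≢⇒== x≢t)))
        (odd-at (c s i) t)
      where
      D : ℕ
      D = countF (λ j → C (len s) i j ∧ f (c s j) == t)
    ...   | yes refl =
      subst ZeroOrOdd (sym (trans (cong (ind (f y == f (x s)) +_) D≡0) (+-identityʳ _))) (ind-ZeroOrOdd _)
      where
      D≡0 : countF (λ j → C (len s) i j ∧ f (c s j) == f (x s)) ≡ 0
      D≡0 = n≤0⇒n≡0 (≤-trans (countF-mono (λ j → proj₂ ∘ ∧≡true (C (len s) i j)))
                             (≤-reflexive (cycleCount-x≡0 s)))

  cycle-colours-apart : ∀ i j → f (c left i) ≢ f (c right j)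
  cycle-colours-apart i j eq = odd+odd-¬ZeroOrOdd
    (cycleCount-odd left i)
    (subst (Odd ∘ cycleCount f right) (sym eq) (cycleCount-odd right j))
    (subst ZeroOrOdd (nbrCount-y f (f (c left i))) (odd-at y (f (c left i))))

  image-restrict : ∀ s {t} → image (restrict s) t ≡ true → t ≡ f y ⊎ ∃ λ i → f (c s i) ≡ t
  image-restrict s found with image⇒∃ (restrict s) found
  ... | v , refl with wheel-view v
  ...   | inj₂ refl = inj₁ (restrict-ctr s)
  ...   | inj₁ (i , refl) = inj₂ (i , sym (restrict-cyc s i))

  palettes-meet-at-y : ∀ t → image (restrict left) t ∧ image (restrict right) t ≡ true → t ≡ f y
  palettes-meet-at-y t both with ∧≡true (image (restrict left) t) both
  ... | inL , inR with image-restrict left inL | image-restrict right inR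
  ...   | inj₁ t≡y | _ = t≡y
  ...   | inj₂ _ | inj₁ t≡y = t≡y
  ...   | inj₂ (i , refl) | inj₂ (j , eq) = ⊥-elim (cycle-colours-apart i j (sym eq))

  palettes-bound : countF (image (restrict left)) + countF (image (restrict right)) ≤ k + 1
  palettes-bound = countF+countF≤ (image (restrict left)) (image (restrict right)) (f y) palettes-meet-at-y

lower-bound : ∀ {m n a b k} →
  IsChiSO (W m) a → IsChiSO (W n) b → HasStrongOdd (Iy m n) k → a + b ∸ 1 ≤ k
lower-bound {m} {n} {a} {b} {k} (_ , minimal-a) (_ , minimal-b) (col , so) = begin
  a + b ∸ 1
    ≤⟨ ∸-monoˡ-≤ 1 (+-mono-≤ a≤ b≤) ⟩
  countF (image (restrict left)) + countF (image (restrict right)) ∸ 1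
    ≤⟨ ∸-monoˡ-≤ 1 palettes-bound ⟩
  k + 1 ∸ 1
    ≡⟨ m+n∸n≡m k 1 ⟩
  k
    ∎
  where
  open ≤-Reasoning
  open IyStructure m n
  open Restriction (col ∘ toFin) (IsStrongOdd-≗ (λ p → cong col (sym (toFin-fromFin p))) so)
  a≤ : a ≤ countF (image (restrict left))
  a≤ = minimal-a _ (compress (restrict-IsStrongOdd left))
  b≤ : b ≤ countF (image (restrict right))
  b≤ = minimal-b _ (compress (restrict-IsStrongOdd right))

↑ˡ≢↑ʳ : ∀ {a b} (l : Fin a) (r : Fin b) → l ↑ˡ b ≢ a ↑ʳ r
↑ˡ≢↑ʳ {a} {b} l r eq
  with trans (sym (splitAt-↑ˡ a l b)) (trans (cong (splitAt a) eq) (splitAt-↑ʳ a b r))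
... | ()

module Amalgamation {m n a b : ℕ}
  (wheel : (s : Side) → CentredStrongOdd (sided m n s) (sided a b s))
  (rim : (s : Side) → Fin (sided m n s)) where

  open IyStructure m n

  κ : (s : Side) → Fin (len s + 1) → Fin (suc (sided a b s))
  κ s = proj₁ (wheel s)

  κ-IsStrongOdd : ∀ s → IsStrongOdd (W (len s)) (κ s)
  κ-IsStrongOdd s = proj₁ (proj₂ (wheel s))

  κ-ctr : ∀ s → κ s ctr ≡ zero
  κ-ctr s = proj₂ (proj₂ (wheel s))

  κ-cyc≢zero : ∀ s i → κ s (cyc i) ≢ zero
  κ-cyc≢zero s i eq = proj₁ (κ-IsStrongOdd s) ctr (cyc i) (W-ctr-cyc i) (trans (κ-ctr s) (sym eq))

  shared : Fin (a + suc b)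
  shared = a ↑ʳ zero

  -- Colour 0 of either wheel becomes the shared colour, the other colours of the left wheel
  -- the first a colours and those of the right wheel the last b.
  ι : (s : Side) → Fin (suc (sided a b s)) → Fin (a + suc b)
  ι left zero = shared
  ι left (suc l) = l ↑ˡ suc b
  ι right r = a ↑ʳ r

  ι-zero : ∀ s → ι s zero ≡ shared
  ι-zero left = refl
  ι-zero right = refl

  ι-injective : ∀ s {p q} → ι s p ≡ ι s q → p ≡ q
  ι-injective left {zero} {zero} _ = refl
  ι-injective left {zero} {suc q} eq = ⊥-elim (↑ˡ≢↑ʳ q zero (sym eq))
  ι-injective left {suc p} {zero} eq = ⊥-elim (↑ˡ≢↑ʳ p zero eq)
  ι-injective left {suc p} {suc q} eq = cong suc (↑ˡ-injective (suc b) p q eq)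
  ι-injective right eq = ↑ʳ-injective a _ _ eq

  ι-apart : ∀ {s s′ p q} → s ≢ s′ → ι s p ≡ ι s′ q → p ≡ zero
  ι-apart {left} {left} s≢s′ _ = ⊥-elim (s≢s′ refl)
  ι-apart {right} {right} s≢s′ _ = ⊥-elim (s≢s′ refl)
  ι-apart {left} {right} {zero} _ _ = refl
  ι-apart {left} {right} {suc p} {q} _ eq = ⊥-elim (↑ˡ≢↑ʳ p q eq)
  ι-apart {right} {left} {q = zero} _ eq = ↑ʳ-injective a _ _ eq
  ι-apart {right} {left} {p} {suc q} _ eq = ⊥-elim (↑ˡ≢↑ʳ q p (sym eq))

  ι-cover : ∀ s t → (∃ λ p → t ≡ ι s p) ⊎ (∃ λ q → q ≢ zero × t ≡ ι (opposite s) q)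
  ι-cover left t with splitAt a t in eq
  ... | inj₁ l = inj₁ (suc l , sym (splitAt⁻¹-↑ˡ eq))
  ... | inj₂ zero = inj₁ (zero , sym (splitAt⁻¹-↑ʳ eq))
  ... | inj₂ (suc r) = inj₂ (suc r , (λ ()) , sym (splitAt⁻¹-↑ʳ eq))
  ι-cover right t with splitAt a t in eq
  ... | inj₁ l = inj₂ (suc l , (λ ()) , sym (splitAt⁻¹-↑ˡ eq))
  ... | inj₂ r = inj₁ (r , sym (splitAt⁻¹-↑ʳ eq))

  colourᵥ : Vertex → Fin (a + suc b)
  colourᵥ y = shared
  colourᵥ (x s) = ι (opposite s) (κ (opposite s) (cyc (rim (opposite s))))
  colourᵥ (c s i) = ι s (κ s (cyc i))

  nbrᴵ : Vertex → Fin (a + suc b) → ℕ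
  nbrᴵ v = nbrCount (Iy m n) (colouring colourᵥ) (toFin v)

  nbrᵂ : (s : Side) → Fin (len s + 1) → Fin (suc (sided a b s)) → ℕ
  nbrᵂ s = nbrCount (W (len s)) (κ s)

  colour-x≢ι : ∀ s p → colourᵥ (x s) ≢ ι s p
  colour-x≢ι s p = κ-cyc≢zero (opposite s) (rim (opposite s)) ∘ ι-apart (opposite≢ s)

  cycleCount-ι : ∀ s p → cycleCount colourᵥ s (ι s p) ≡ nbrᵂ s ctr p
  cycleCount-ι s p =
    trans (countF-cong {q = λ i → κ s (cyc i) == p} (λ i → ==-cong-⇔ (ι-injective s) (cong (ι s))))
          (sym (nbrCount-ctr (κ s) p))

  cycleCount-ι-apart : ∀ {s s′} → s ≢ s′ → ∀ p → cycleCount colourᵥ s (ι s′ p) ≡ 0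
  cycleCount-ι-apart {s} s≢s′ p = countF-none (λ i → ≢⇒== (κ-cyc≢zero s i ∘ ι-apart s≢s′))

  nbrCount-y-ι : ∀ s p → nbrᴵ y (ι s p) ≡ nbrᵂ s ctr p
  nbrCount-y-ι left p = trans (nbrCount-y colourᵥ (ι left p))
    (trans (cong₂ _+_ (cycleCount-ι left p) (cycleCount-ι-apart {right} (λ ()) p)) (+-identityʳ _))
  nbrCount-y-ι right p = trans (nbrCount-y colourᵥ (ι right p))
    (cong₂ _+_ (cycleCount-ι-apart {left} (λ ()) p) (cycleCount-ι right p))

  nbrCount-x-ι : ∀ s p → nbrᴵ (x s) (ι s p) ≡ nbrᵂ s ctr p
  nbrCount-x-ι s p = trans (nbrCount-x colourᵥ s (ι s p)) (cycleCount-ι s p)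

  nbrCount-x-ι-opposite : ∀ s q → nbrᴵ (x s) (ι (opposite s) q) ≡ 0
  nbrCount-x-ι-opposite s q = trans (nbrCount-x colourᵥ s _) (cycleCount-ι-apart (opposite≢ s ∘ sym) q)

  nbrCount-c-ι : ∀ s i p →
    nbrᴵ (c s i) (ι s p) ≡ nbrᵂ s (cyc i) p
  nbrCount-c-ι s i p = begin
    nbrᴵ (c s i) (ι s p)
      ≡⟨ nbrCount-c colourᵥ s i (ι s p) ⟩
    ind (shared == ι s p) + (ind (colourᵥ (x s) == ι s p) + D)
      ≡⟨ cong₂ (λ h e → ind h + (ind e + D)) (==-cong-⇔ shared≡⇒ ⇒shared≡) (≢⇒== (colour-x≢ι s p)) ⟩
    ind (κ s ctr == p) + D
      ≡⟨ cong (ind (κ s ctr == p) +_)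
              (countF-cong (λ j → cong (C (len s) i j ∧_) (==-cong-⇔ (ι-injective s) (cong (ι s))))) ⟩
    ind (κ s ctr == p) + countF (λ j → C (len s) i j ∧ κ s (cyc j) == p)
      ≡⟨ nbrCount-cyc (κ s) p i ⟨
    nbrᵂ s (cyc i) p
      ∎
    where
    open ≡-Reasoning
    D : ℕ
    D = countF (λ j → C (len s) i j ∧ ι s (κ s (cyc j)) == ι s p)
    shared≡⇒ : shared ≡ ι s p → κ s ctr ≡ p
    shared≡⇒ eq = trans (κ-ctr s) (ι-injective s (trans (ι-zero s) eq))
    ⇒shared≡ : κ s ctr ≡ p → shared ≡ ι s p
    ⇒shared≡ eq = trans (sym (ι-zero s)) (cong (ι s) (trans (sym (κ-ctr s)) eq))

  nbrCount-c-ι-opposite : ∀ s i {q} → q ≢ zero →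
    nbrᴵ (c s i) (ι (opposite s) q) ≡ ind (colourᵥ (x s) == ι (opposite s) q)
  nbrCount-c-ι-opposite s i {q} q≢0 = begin
    nbrᴵ (c s i) t
      ≡⟨ nbrCount-c colourᵥ s i t ⟩
    ind (shared == t) + (ind (colourᵥ (x s) == t) + D)
      ≡⟨ cong₂ (λ h d → ind h + (ind (colourᵥ (x s) == t) + d)) (≢⇒== shared≢t) D≡0 ⟩
    ind (colourᵥ (x s) == t) + 0
      ≡⟨ +-identityʳ _ ⟩
    ind (colourᵥ (x s) == t)
      ∎
    where
    open ≡-Reasoning
    t : Fin (a + suc b)
    t = ι (opposite s) q
    shared≢t : shared ≢ t
    shared≢t = q≢0 ∘ sym ∘ ι-injective (opposite s) ∘ trans (ι-zero (opposite s))
    D : ℕ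
    D = countF (λ j → C (len s) i j ∧ ι s (κ s (cyc j)) == t)
    D≡0 : D ≡ 0
    D≡0 = n≤0⇒n≡0 (≤-trans (countF-mono (λ j → proj₂ ∘ ∧≡true (C (len s) i j)))
                           (≤-reflexive (cycleCount-ι-apart (opposite≢ s ∘ sym) q)))

  odd-at : ∀ v t → ZeroOrOdd (nbrᴵ v t)
  odd-at y t with ι-cover left t
  ... | inj₁ (p , refl) = subst ZeroOrOdd (sym (nbrCount-y-ι left p)) (proj₂ (κ-IsStrongOdd left) ctr p)
  ... | inj₂ (q , _ , refl) =
    subst ZeroOrOdd (sym (nbrCount-y-ι right q)) (proj₂ (κ-IsStrongOdd right) ctr q)
  odd-at (x s) t with ι-cover s t
  ... | inj₁ (p , refl) = subst ZeroOrOdd (sym (nbrCount-x-ι s p)) (proj₂ (κ-IsStrongOdd s) ctr p)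
  ... | inj₂ (q , _ , refl) = inj₁ (nbrCount-x-ι-opposite s q)
  odd-at (c s i) t with ι-cover s t
  ... | inj₁ (p , refl) = subst ZeroOrOdd (sym (nbrCount-c-ι s i p)) (proj₂ (κ-IsStrongOdd s) (cyc i) p)
  ... | inj₂ (q , q≢0 , refl) = subst ZeroOrOdd (sym (nbrCount-c-ι-opposite s i q≢0)) (ind-ZeroOrOdd _)

  own≡0 : ∀ v → nbrᴵ v (colourᵥ v) ≡ 0
  own≡0 y = trans (nbrCount-y-ι left zero)
    (subst (λ h → nbrᵂ left ctr h ≡ 0) (κ-ctr left)
      (Proper⇒nbrCount-own≡0 _ _ (proj₁ (κ-IsStrongOdd left)) ctr))
  own≡0 (x s) = nbrCount-x-ι-opposite s _
  own≡0 (c s i) =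
    trans (nbrCount-c-ι s i _) (Proper⇒nbrCount-own≡0 _ _ (proj₁ (κ-IsStrongOdd s)) (cyc i))

  amalgamation : HasStrongOdd (Iy m n) (a + suc b)
  amalgamation = colouring colourᵥ , nbrCount-own≡0⇒Properᵥ colourᵥ own≡0 , toFin-elim odd-at

upper-bound : ∀ {m n a b} → 1 ≤ m → 1 ≤ n → HasStrongOdd (W m) a → HasStrongOdd (W n) b →
  HasStrongOdd (Iy m n) (a + b ∸ 1)
upper-bound {zero} () _ _ _
upper-bound {n = zero} _ () _ _
upper-bound {a = zero} _ _ (κ , _) _ with () ← κ ctr
upper-bound {b = zero} _ _ _ (κ , _) with () ← κ ctr
upper-bound {suc m} {suc n} {suc a} {suc b} _ _ (κˡ , soˡ) (κʳ , soʳ) = Amalgamation.amalgamation wheel rim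
  where
  wheel : (s : Side) → CentredStrongOdd (sided (suc m) (suc n) s) (sided a b s)
  wheel left = IsStrongOdd-zero-at soˡ (ctr {suc m})
  wheel right = IsStrongOdd-zero-at soʳ (ctr {suc n})
  rim : (s : Side) → Fin (sided (suc m) (suc n) s)
  rim left = zero
  rim right = zero

theorem3 : ∀ m n → 3 ≤ m → 3 ≤ n → ∀ a b →
    IsChiSO (W m) a → IsChiSO (W n) b → IsChiSO (Iy m n) (a + b ∸ 1)
theorem3 m n 3≤m 3≤n a b χa χb =
  upper-bound (≤-trans (s≤s z≤n) 3≤m) (≤-trans (s≤s z≤n) 3≤n) (proj₁ χa) (proj₁ χb) ,
  λ k → lower-bound χa χb
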